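{- Let $k\ge4$ be even. Then for any $A\subseteq\mathbb{N}$ with $\min(A)=0$, $\max(A)\le k$ and $A\subsetneq[k]$, there exists an additive divisor $F_k$ of $[k]$ such that $F_k\notin F(B)$ for every additive divisor $B$ of $A$.
   Context: $\mathbb{N}=\{0,1,2,\ldots\}$, $[k]=\{0,1,\ldots,k\}$, and $X+Y=\{x+y:x\in X,y\in Y\}$. A set $B\subseteq\mathbb{N}$ is an additive divisor of a set $E$ if $B+C=E$ for some $C\subseteq\mathbb{N}$. For sets $X,Y\subseteq\mathbb{N}$ with $X+Y=A$, define (relative to $k$ and $A$) the promotion $Y_X=Y\cup\{s\in[k]\setminus A:s<\max(X)\}\cup\{s-\max(X):s\in[k]\setminus A,\ s\ge\max(X)\}$. For an additive divisor $B$ of $A$, $F(B)$ is the collection of sets consisting of: $B$ itself, provided there exists $C\subseteq\mathbb{N}$ with $B+C=A$ and $\max(B)\le\max(C)$; and $B_C$ for every $C\subseteq\mathbb{N}$ with $B+C=A$ and $\max(C)\le\max(B)$. -}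

module Defs where

open import Data.Nat using (ℕ; _+_; _≤_; _<ᵇ_; _≤ᵇ_)
open import Data.Bool using (Bool; true; false; _∧_; _∨_; not)
open import Data.Product using (Σ; _×_; ∃; ∃-syntax)
open import Data.Sum using (_⊎_)
open import Relation.Binary.PropositionalEquality using (_≡_)
open import Function.Bundles using (_⇔_)

NSet : Set
NSet = ℕ → Bool

infix 4 _∈_ _≐_
_∈_ : ℕ → NSet → Set
n ∈ X = X n ≡ true

_≐_ : NSet → NSet → Set
X ≐ Y = ∀ n → X n ≡ Y n

interval : ℕ → NSet
interval k s = s ≤ᵇ k

IsSumset : NSet → NSet → NSet → Set
IsSumset X Y E = ∀ s → (s ∈ E) ⇔ (∃[ x ] ∃[ y ] (x ∈ X × y ∈ Y × x + y ≡ s))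

AdditiveDivisor : NSet → NSet → Set
AdditiveDivisor B E = ∃[ C ] IsSumset B C E

IsMax : NSet → ℕ → Set
IsMax X m = m ∈ X × (∀ x → x ∈ X → x ≤ m)

-- Promotion Y_X relative to k and A, where m = max(X):
-- Y ∪ {s ∈ [k]∖A : s < m} ∪ {t - m : t ∈ [k]∖A, t ≥ m}
-- (the last set is written via t = s + m).
promotion : ℕ → NSet → NSet → ℕ → NSet
promotion k A Y m s =
  Y s
  ∨ ((s <ᵇ m) ∧ (interval k s ∧ not (A s)))
  ∨ (interval k (s + m) ∧ not (A (s + m)))

InF : ℕ → NSet → NSet → NSet → Set
InF k A B D =
  (∃[ C ] (IsSumset B C A × ∃[ mB ] ∃[ mC ]
      (IsMax B mB × IsMax C mC × mB ≤ mC × D ≐ B)))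
  ⊎
  (∃[ C ] (IsSumset B C A × ∃[ mB ] ∃[ mC ]
      (IsMax B mB × IsMax C mC × mC ≤ mB × D ≐ promotion k A B mC)))

-- The witness is E = {even numbers ≤ k − 2}, a divisor of [k] since E + [2] = [k].
-- If E lies in F(B) for B + C = A, then 1 ∈ C, max C = 2 and E ⊆ B (directly, or
-- because each odd t + 1 ∈ A can only split as t + 1 with t ∈ B), so A ⊇ E + [2] = [k],
-- contradicting A ≠ [k]. For a promotion, each s ∈ [k] ∖ A with s ≥ max C puts s − max C
-- into E, so s ≡ max C (mod 2); this forces max C even and all odd numbers < k into A.
-- When k = 4 and 1 ∉ A the argument breaks down (E = {0,2} is B for A = {0,2} + {0,2}),
-- and {0,1,3} serves instead.
module Submission where

open import Defs
open import Data.Nat using (ℕ; _≤_)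
open import Data.Nat.Divisibility using (_∣_)
open import Data.Product using (_×_; ∃-syntax)
open import Relation.Nullary using (¬_)

open import Data.Bool using (true; false; _∧_; _∨_)
open import Data.Bool.Properties using (T-≡; T-not-≡; T-∧; T-∨; ¬-not; ∨-zeroʳ)
import Data.Bool.Properties as Bool
open import Data.Empty using (⊥)
open import Data.Nat using (zero; suc; _+_; _∸_; _<_; parity; z≤n; s≤s)
open import Data.Nat.Divisibility using (divides)
open import Data.Nat.Properties
open import Data.Parity.Base as ℙ using (0ℙ; 1ℙ; _⁻¹)
import Data.Parity.Properties as ℙ
open import Data.Product using (_,_; proj₁; proj₂)
open import Data.Sum using (_⊎_; inj₁; inj₂; [_,_])
open import Function.Base using (_∘_)
open import Function.Bundles using (mk⇔; Equivalence)
open import Relation.Binary.PropositionalEquality using (_≡_; refl; sym; trans; cong; subst; module ≡-Reasoning)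
open import Relation.Nullary using (yes; no; does; contradiction)
open import Relation.Nullary.Decidable using (_⊎-dec_)

open Equivalence using (to; from)

infix 4 _⊆_
_⊆_ : NSet → NSet → Set
X ⊆ Y = ∀ {n} → n ∈ X → n ∈ Y

≐⇒⊆ : ∀ {X Y} → X ≐ Y → X ⊆ Y
≐⇒⊆ X≐Y {n} n∈X = trans (sym (X≐Y n)) n∈X

≐⇒⊇ : ∀ {X Y} → X ≐ Y → Y ⊆ X
≐⇒⊇ X≐Y {n} n∈Y = trans (X≐Y n) n∈Y

∉⇐false : ∀ {X n} → X n ≡ false → ¬ n ∈ X
∉⇐false X[n]≡false n∈X with () ← trans (sym n∈X) X[n]≡false

∈-interval⁺ : ∀ {k s} → s ≤ k → s ∈ interval k
∈-interval⁺ s≤k = to T-≡ (≤⇒≤ᵇ s≤k)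

∈-interval⁻ : ∀ {k s} → s ∈ interval k → s ≤ k
∈-interval⁻ {k} {s} s∈[k] = ≤ᵇ⇒≤ s k (from T-≡ s∈[k])

interval2⊆ : ∀ {C} → 0 ∈ C → 1 ∈ C → 2 ∈ C → interval 2 ⊆ C
interval2⊆ 0∈C _   _   {0} _ = 0∈C
interval2⊆ _   1∈C _   {1} _ = 1∈C
interval2⊆ _   _   2∈C {2} _ = 2∈C

m+n≤o+m⇒n≤o : ∀ m n o → m + n ≤ o + m → n ≤ o
m+n≤o+m⇒n≤o m n o m+n≤o+m = +-cancelˡ-≤ m n o (≤-trans m+n≤o+m (≤-reflexive (+-comm o m)))

parity-suc : ∀ n → parity (suc n) ≡ parity n ⁻¹
parity-suc n = sym (ℙ.⁻¹-selfInverse (ℙ.suc-homo-⁻¹ n))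

parity-+ˡ-even : ∀ m n → parity m ≡ 0ℙ → parity (m + n) ≡ parity n
parity-+ˡ-even m n m-even = trans (ℙ.+-homo-+ m n) (cong (ℙ._+ parity n) m-even)

2∣⇒even : ∀ {n} → 2 ∣ n → parity n ≡ 0ℙ
2∣⇒even (divides q refl) = trans (ℙ.*-homo-* q 2) (ℙ.*-zeroʳ (parity q))

≤suc⇒≤-sameParity : ∀ {t j} → parity t ≡ parity j → t ≤ suc j → t ≤ j
≤suc⇒≤-sameParity {t} {j} same t≤1+j with m≤n⇒m<n∨m≡n t≤1+j
... | inj₁ t<1+j = ≤-pred t<1+j
... | inj₂ refl  = contradiction (trans (sym same) (parity-suc j)) (ℙ.p≢p⁻¹ (parity j))

odd≤2⇒≡1 : ∀ {n} → parity n ≡ 1ℙ → n ≤ 2 → n ≡ 1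
odd≤2⇒≡1 {1} _ _ = refl
odd≤2⇒≡1 {suc (suc (suc _))} _ (s≤s (s≤s ()))

even-1≤-≤2⇒≡2 : ∀ {n} → parity n ≡ 0ℙ → 1 ≤ n → n ≤ 2 → n ≡ 2
even-1≤-≤2⇒≡2 {2} _ _ _ = refl
even-1≤-≤2⇒≡2 {suc (suc (suc _))} _ _ (s≤s (s≤s ()))

evensUpTo : ℕ → NSet
evensUpTo j s = does (parity s ℙ.≟ 0ℙ) ∧ interval j s

∈-evensUpTo⁺ : ∀ {j s} → parity s ≡ 0ℙ → s ≤ j → s ∈ evensUpTo j
∈-evensUpTo⁺ s-even s≤j rewrite s-even = ∈-interval⁺ s≤j

∈-evensUpTo⁻ : ∀ {j s} → s ∈ evensUpTo j → parity s ≡ 0ℙ × s ≤ j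
∈-evensUpTo⁻ {j} {s} s∈E with parity s ℙ.≟ 0ℙ
∈-evensUpTo⁻ s∈E  | yes s-even = s-even , ∈-interval⁻ s∈E
∈-evensUpTo⁻ ()   | no _

1∉evensUpTo : ∀ {j} → ¬ 1 ∈ evensUpTo j
1∉evensUpTo ()

evensUpTo+[2] : ∀ {j} → parity j ≡ 0ℙ → IsSumset (evensUpTo j) (interval 2) (interval (2 + j))
evensUpTo+[2] {j} j-even s = mk⇔ (split ∘ ∈-interval⁻) join
  where
  Split : ℕ → Set
  Split s = ∃[ e ] ∃[ c ] (e ∈ evensUpTo j × c ∈ interval 2 × e + c ≡ s)

  splitBelow : ∀ s → s ≤ suc j → Split s
  splitBelow zero _ = 0 , 0 , ∈-evensUpTo⁺ {j} refl z≤n , refl , refl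
  splitBelow (suc u) (s≤s u≤j) with parity u in u-parity
  ... | 0ℙ = u , 1 , ∈-evensUpTo⁺ {j} u-parity u≤j , refl , +-comm u 1
  ... | 1ℙ = suc u , 0 , ∈-evensUpTo⁺ {j} 1+u-even 1+u≤j , refl , +-identityʳ (suc u)
    where
    1+u-even : parity (suc u) ≡ 0ℙ
    1+u-even = trans (parity-suc u) (cong _⁻¹ u-parity)
    1+u≤j : suc u ≤ j
    1+u≤j = ≤suc⇒≤-sameParity (trans 1+u-even (sym j-even)) (s≤s u≤j)

  split : ∀ {s} → s ≤ 2 + j → Split s
  split s≤2+j with m≤n⇒m<n∨m≡n s≤2+j
  ... | inj₁ (s≤s s≤1+j) = splitBelow _ s≤1+j
  ... | inj₂ refl        = j , 2 , ∈-evensUpTo⁺ {j} j-even ≤-refl , refl , +-comm j 2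

  join : Split s → s ∈ interval (2 + j)
  join (e , c , e∈E , c∈[2] , refl) = ∈-interval⁺ (begin
    e + c ≤⟨ +-mono-≤ (proj₂ (∈-evensUpTo⁻ {j} {e} e∈E)) (∈-interval⁻ {2} {c} c∈[2]) ⟩
    j + 2 ≡⟨ +-comm j 2 ⟩
    2 + j ∎)
    where open ≤-Reasoning

evensUpTo-divides : ∀ {j} → parity j ≡ 0ℙ → AdditiveDivisor (evensUpTo j) (interval (2 + j))
evensUpTo-divides j-even = interval 2 , evensUpTo+[2] j-even

module Sumset {B C A : NSet} (B+C=A : IsSumset B C A) where

  +-∈ : ∀ {b c} → b ∈ B → c ∈ C → b + c ∈ A
  +-∈ {b} {c} b∈B c∈C = from (B+C=A (b + c)) (b , c , b∈B , c∈C , refl)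

  split : ∀ {s} → s ∈ A → ∃[ b ] ∃[ c ] (b ∈ B × c ∈ C × b + c ≡ s)
  split {s} = to (B+C=A s)

  0∈B : 0 ∈ A → 0 ∈ B
  0∈B 0∈A with split 0∈A
  ... | 0 , 0 , 0∈B , _ , _ = 0∈B

  0∈C : 0 ∈ A → 0 ∈ C
  0∈C 0∈A with split 0∈A
  ... | 0 , 0 , _ , 0∈C , _ = 0∈C

  B⊆A : 0 ∈ A → B ⊆ A
  B⊆A 0∈A {b} b∈B = subst (_∈ A) (+-identityʳ b) (+-∈ b∈B (0∈C 0∈A))

  C⊆A : 0 ∈ A → C ⊆ A
  C⊆A 0∈A c∈C = +-∈ (0∈B 0∈A) c∈C

  ≤max+max : ∀ {mB mC s} → IsMax B mB → IsMax C mC → s ∈ A → s ≤ mB + mC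
  ≤max+max (_ , ≤mB) (_ , ≤mC) s∈A with split s∈A
  ... | b , c , b∈B , c∈C , refl = +-mono-≤ (≤mB b b∈B) (≤mC c c∈C)

  1∈A⇒1∈C : ¬ 1 ∈ B → 1 ∈ A → 1 ∈ C
  1∈A⇒1∈C 1∉B 1∈A with split 1∈A
  ... | 0 , 1 , _   , 1∈C , _ = 1∈C
  ... | 1 , 0 , 1∈B , _   , _ = contradiction 1∈B 1∉B

  A⊆B : IsMax C 0 → A ⊆ B
  A⊆B (_ , ≤0) s∈A with split s∈A
  ... | b , c , b∈B , c∈C , b+c≡s with n≤0⇒n≡0 (≤0 c c∈C)
  ...   | refl = subst (_∈ B) (trans (sym (+-identityʳ b)) b+c≡s) b∈B

  sumset-⊆ : ∀ {X Y Z} → IsSumset X Y Z → X ⊆ B → Y ⊆ C → Z ⊆ A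
  sumset-⊆ X+Y=Z X⊆B Y⊆C {s} s∈Z with to (X+Y=Z s) s∈Z
  ... | x , y , x∈X , y∈Y , refl = +-∈ (X⊆B x∈X) (Y⊆C y∈Y)

module Promotion {k : ℕ} {A Y : NSet} {m : ℕ} where

  ⊆-promotion : Y ⊆ promotion k A Y m
  ⊆-promotion {s} s∈Y rewrite s∈Y = refl

  ∈-promotion-below : ∀ {s} → s < m → s ≤ k → ¬ s ∈ A → s ∈ promotion k A Y m
  ∈-promotion-below {s} s<m s≤k s∉A
    rewrite to T-≡ (<⇒<ᵇ s<m) | ∈-interval⁺ s≤k | ¬-not s∉A = ∨-zeroʳ (Y s)

  ∈-promotion-above : ∀ {s} → m ≤ s → s ≤ k → ¬ s ∈ A → s ∸ m ∈ promotion k A Y m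
  ∈-promotion-above {s} m≤s s≤k s∉A rewrite m∸n+n≡m m≤s | ∈-interval⁺ s≤k | ¬-not s∉A =
    trans (cong (Y (s ∸ m) ∨_) (∨-zeroʳ _)) (∨-zeroʳ (Y (s ∸ m)))

  ∈-promotion⁻ : ∀ {s} → s ∈ promotion k A Y m →
    s ∈ Y ⊎ s < m ⊎ (s + m ≤ k × ¬ s + m ∈ A)
  ∈-promotion⁻ {s} s∈D with to T-∨ (from T-≡ s∈D)
  ... | inj₁ s∈Y = inj₁ (to T-≡ s∈Y)
  ... | inj₂ rest with to T-∨ rest
  ...   | inj₁ below = inj₂ (inj₁ (<ᵇ⇒< s m (proj₁ (to T-∧ below))))
  ...   | inj₂ above with to T-∧ above
  ...     | s+m≤k , s+m∉A = inj₂ (inj₂ (≤ᵇ⇒≤ (s + m) k s+m≤k , ∉⇐false {A} (to T-not-≡ s+m∉A)))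

interval⊆promotion : ∀ {k A Y} → A ⊆ Y → interval k ⊆ promotion k A Y 0
interval⊆promotion {k} {A} {Y} A⊆Y {s} s∈[k] with A s in A[s]
... | true  = Promotion.⊆-promotion {k} {A} {Y} {0} (A⊆Y A[s])
... | false = Promotion.∈-promotion-above {k} {A} {Y} {0} z≤n (∈-interval⁻ s∈[k]) (∉⇐false {A} A[s])

¬InF : ∀ {k A D} →
  (∀ {B C mB mC} → IsSumset B C A → IsMax B mB → IsMax C mC → mB ≤ mC → D ≐ B → ⊥) →
  (∀ {B C mB mC} → IsSumset B C A → IsMax B mB → IsMax C mC → mC ≤ mB →
     D ≐ promotion k A B mC → ⊥) →
  ∀ B → ¬ InF k A B D
¬InF unpromoted _ _ (inj₁ (_ , B+C=A , _ , _ , max-B , max-C , mB≤mC , D≐B)) =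
  unpromoted B+C=A max-B max-C mB≤mC D≐B
¬InF _ promoted _ (inj₂ (_ , B+C=A , _ , _ , max-B , max-C , mC≤mB , D≐B_C)) =
  promoted B+C=A max-B max-C mC≤mB D≐B_C

evensUpTo+[2]⊆ : ∀ {j B C A} → parity j ≡ 0ℙ → IsSumset B C A →
  evensUpTo j ⊆ B → 0 ∈ C → 1 ∈ C → 2 ∈ C → interval (2 + j) ⊆ A
evensUpTo+[2]⊆ {C = C} j-even B+C=A E⊆B 0∈C 1∈C 2∈C =
  Sumset.sumset-⊆ B+C=A (evensUpTo+[2] j-even) E⊆B (interval2⊆ {C} 0∈C 1∈C 2∈C)

module EvensUpToWitness {j : ℕ} {A : NSet} (j-even : parity j ≡ 0ℙ) (2≤j : 2 ≤ j)
  (A⊆[k] : ∀ a → a ∈ A → a ≤ 2 + j) (0∈A : 0 ∈ A) (A⊉[k] : ¬ interval (2 + j) ⊆ A) where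

  unpromoted : 1 ∈ A ⊎ 3 ≤ j → ∀ {B C mB mC} → IsSumset B C A → IsMax B mB → IsMax C mC →
    mB ≤ mC → evensUpTo j ≐ B → ⊥
  unpromoted 1∈A⊎3≤j {C = C} {mB} {mC} B+C=A (mB∈B , ≤mB) (mC∈C , _) mB≤mC E≐B =
    [ using-1∈A , using-3≤j ] 1∈A⊎3≤j
    where
    open Sumset B+C=A
    j≤mB : j ≤ mB
    j≤mB = ≤mB j (≐⇒⊆ E≐B (∈-evensUpTo⁺ {j} j-even ≤-refl))
    j≤mC : j ≤ mC
    j≤mC = ≤-trans j≤mB mB≤mC
    mC≤2 : mC ≤ 2
    mC≤2 = m+n≤o+m⇒n≤o j mC 2 (≤-trans (+-monoˡ-≤ mC j≤mB) (A⊆[k] _ (+-∈ mB∈B mC∈C)))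
    mC≡2 : mC ≡ 2
    mC≡2 = ≤-antisym mC≤2 (≤-trans 2≤j j≤mC)
    using-3≤j : 3 ≤ j → ⊥
    using-3≤j 3≤j = <⇒≱ (≤-trans 3≤j j≤mC) mC≤2
    using-1∈A : 1 ∈ A → ⊥
    using-1∈A 1∈A = A⊉[k] (evensUpTo+[2]⊆ j-even B+C=A (≐⇒⊆ E≐B) (0∈C 0∈A)
      (1∈A⇒1∈C (1∉evensUpTo {j} ∘ ≐⇒⊇ E≐B) 1∈A) (subst (_∈ C) mC≡2 mC∈C))

  promoted : ∀ {B C mB mC} → IsSumset B C A → IsMax B mB → IsMax C mC → mC ≤ mB →
    evensUpTo j ≐ promotion (2 + j) A B mC → ⊥
  promoted {B} {C} {mB} {mC} B+C=A max-B@(mB∈B , _) max-C@(mC∈C , ≤mC) mC≤mB E≐D =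
    A⊉[k] (evensUpTo+[2]⊆ j-even B+C=A E⊆B (0∈C 0∈A) 1∈C (subst (_∈ C) mC≡2 mC∈C))
    where
    open Sumset B+C=A
    open Promotion {2 + j} {A} {B} {mC}
    D⊆E : promotion (2 + j) A B mC ⊆ evensUpTo j
    D⊆E = ≐⇒⊇ E≐D
    B⊆E : B ⊆ evensUpTo j
    B⊆E = D⊆E ∘ ⊆-promotion
    mB-even : parity mB ≡ 0ℙ
    mB-even = proj₁ (∈-evensUpTo⁻ {j} {mB} (B⊆E mB∈B))
    mC≤j : mC ≤ j
    mC≤j = ≤-trans mC≤mB (proj₂ (∈-evensUpTo⁻ {j} {mB} (B⊆E mB∈B)))

    ∉A⇒parity≡ : ∀ {s} → mC ≤ s → s ≤ 2 + j → ¬ s ∈ A → parity s ≡ parity mC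
    ∉A⇒parity≡ {s} mC≤s s≤k s∉A = begin
      parity s                 ≡⟨ cong parity (m∸n+n≡m mC≤s) ⟨
      parity (s ∸ mC + mC)     ≡⟨ parity-+ˡ-even (s ∸ mC) mC s∸mC-even ⟩
      parity mC                ∎
      where
      open ≡-Reasoning
      s∸mC-even : parity (s ∸ mC) ≡ 0ℙ
      s∸mC-even = proj₁ (∈-evensUpTo⁻ {j} {s ∸ mC} (D⊆E (∈-promotion-above mC≤s s≤k s∉A)))

    mC-even : parity mC ≡ 0ℙ
    mC-even with A (2 + j) in A[k]
    ... | true  = trans (sym (parity-+ˡ-even mB mC mB-even)) (trans (cong parity mB+mC≡k) j-even)
      where
      mB+mC≡k : mB + mC ≡ 2 + j
      mB+mC≡k = ≤-antisym (A⊆[k] _ (+-∈ mB∈B mC∈C)) (≤max+max max-B max-C A[k])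
    ... | false = trans (sym (∉A⇒parity≡ (≤-trans mC≤j (m≤n+m j 2)) ≤-refl (∉⇐false {A} A[k])))
                        j-even

    odd∈A : ∀ {t} → parity t ≡ 1ℙ → t ≤ suc j → t ∈ A
    odd∈A {t} t-odd t≤1+j with A t in A[t]
    ... | true  = refl
    ... | false with t <? mC
    ...   | yes t<mC = contradiction (trans (sym t-odd) t-even) λ ()
      where
      t-even : parity t ≡ 0ℙ
      t-even = proj₁ (∈-evensUpTo⁻ {j} {t}
        (D⊆E (∈-promotion-below t<mC (≤-trans t≤1+j (n≤1+n _)) (∉⇐false {A} A[t]))))
    ...   | no t≮mC = contradiction (trans (sym t-odd) (trans t≡mC mC-even)) λ ()
      where
      t≡mC : parity t ≡ parity mC
      t≡mC = ∉A⇒parity≡ (≮⇒≥ t≮mC) (≤-trans t≤1+j (n≤1+n _)) (∉⇐false {A} A[t])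

    1∈C : 1 ∈ C
    1∈C = 1∈A⇒1∈C (1∉evensUpTo {j} ∘ B⊆E) (odd∈A refl (s≤s z≤n))

    mC≤2 : mC ≤ 2
    mC≤2 with ∈-promotion⁻ (≐⇒⊆ E≐D (∈-evensUpTo⁺ {j} j-even ≤-refl))
    ... | inj₁ j∈B               = m+n≤o+m⇒n≤o j mC 2
                                     (≤-trans (+-monoˡ-≤ mC (proj₂ max-B j j∈B)) (A⊆[k] _ (+-∈ mB∈B mC∈C)))
    ... | inj₂ (inj₁ j<mC)       = contradiction mC≤j (<⇒≱ j<mC)
    ... | inj₂ (inj₂ (j+mC≤k , _)) = m+n≤o+m⇒n≤o j mC 2 j+mC≤k

    mC≡2 : mC ≡ 2
    mC≡2 = even-1≤-≤2⇒≡2 mC-even (≤mC 1 1∈C) mC≤2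

    -- t + 1 ∈ A splits as b + c with b even, so c ≤ mC = 2 is odd, i.e. c = 1 and b = t.
    E⊆B : evensUpTo j ⊆ B
    E⊆B {t} t∈E with ∈-evensUpTo⁻ {j} {t} t∈E
    ... | t-even , t≤j with split (odd∈A (trans (parity-suc t) (cong _⁻¹ t-even)) (s≤s t≤j))
    ...   | b , c , b∈B , c∈C , b+c≡1+t = subst (_∈ B) b≡t b∈B
      where
      c-odd : parity c ≡ 1ℙ
      c-odd = begin
        parity c        ≡⟨ parity-+ˡ-even b c (proj₁ (∈-evensUpTo⁻ {j} {b} (B⊆E b∈B))) ⟨
        parity (b + c)  ≡⟨ cong parity b+c≡1+t ⟩
        parity (suc t)  ≡⟨ parity-suc t ⟩
        parity t ⁻¹     ≡⟨ cong _⁻¹ t-even ⟩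
        1ℙ              ∎
        where open ≡-Reasoning
      c≡1 : c ≡ 1
      c≡1 = odd≤2⇒≡1 c-odd (subst (c ≤_) mC≡2 (≤mC c c∈C))
      b≡t : b ≡ t
      b≡t = suc-injective (begin
        suc b  ≡⟨ +-comm 1 b ⟩
        b + 1  ≡⟨ cong (b +_) c≡1 ⟨
        b + c  ≡⟨ b+c≡1+t ⟩
        suc t  ∎)
        where open ≡-Reasoning

  ∉InF : 1 ∈ A ⊎ 3 ≤ j → ∀ B → ¬ InF (2 + j) A B (evensUpTo j)
  ∉InF 1∈A⊎3≤j = ¬InF (unpromoted 1∈A⊎3≤j) promoted

zeroOneThree : NSet
zeroOneThree 0 = true
zeroOneThree 1 = true
zeroOneThree 3 = true
zeroOneThree _ = false

zeroOneThree+[1] : IsSumset zeroOneThree (interval 1) (interval 4)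
zeroOneThree+[1] s = mk⇔ (split s) (join s)
  where
  Split : ℕ → Set
  Split s = ∃[ x ] ∃[ y ] (x ∈ zeroOneThree × y ∈ interval 1 × x + y ≡ s)
  split : ∀ s → s ∈ interval 4 → Split s
  split 0 _ = 0 , 0 , refl , refl , refl
  split 1 _ = 1 , 0 , refl , refl , refl
  split 2 _ = 1 , 1 , refl , refl , refl
  split 3 _ = 3 , 0 , refl , refl , refl
  split 4 _ = 3 , 1 , refl , refl , refl
  join : ∀ s → Split s → s ∈ interval 4
  join _ (0 , 0 , _ , _ , refl) = refl
  join _ (0 , 1 , _ , _ , refl) = refl
  join _ (1 , 0 , _ , _ , refl) = refl
  join _ (1 , 1 , _ , _ , refl) = refl
  join _ (3 , 0 , _ , _ , refl) = refl
  join _ (3 , 1 , _ , _ , refl) = refl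

∈zeroOneThree-≥2⇒≡3 : ∀ {n} → n ∈ zeroOneThree → 2 ≤ n → n ≡ 3
∈zeroOneThree-≥2⇒≡3 {1} _ (s≤s ())
∈zeroOneThree-≥2⇒≡3 {3} _ _ = refl

module ZeroOneThreeWitness {A : NSet} (A⊆[4] : ∀ a → a ∈ A → a ≤ 4) (0∈A : 0 ∈ A) (1∉A : ¬ 1 ∈ A)
  where

  unpromoted : ∀ {B C mB mC} → IsSumset B C A → IsMax B mB → IsMax C mC →
    mB ≤ mC → zeroOneThree ≐ B → ⊥
  unpromoted {mB = mB} {mC} B+C=A (mB∈B , ≤mB) (mC∈C , _) mB≤mC G≐B =
    <⇒≱ (m≤m+n 5 1) (≤-trans (+-mono-≤ 3≤mB (≤-trans 3≤mB mB≤mC)) mB+mC≤4)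
    where
    3≤mB : 3 ≤ mB
    3≤mB = ≤mB 3 (≐⇒⊆ G≐B refl)
    mB+mC≤4 : mB + mC ≤ 4
    mB+mC≤4 = A⊆[4] _ (Sumset.+-∈ B+C=A mB∈B mC∈C)

  promoted : ∀ {B C mB mC} → IsSumset B C A → IsMax B mB → IsMax C mC → mC ≤ mB →
    zeroOneThree ≐ promotion 4 A B mC → ⊥
  promoted {B} {mC = zero} B+C=A _ max-C _ G≐D =
    contradiction (≐⇒⊇ G≐D 2∈D) λ ()
    where
    2∈D : 2 ∈ promotion 4 A B 0
    2∈D = interval⊆promotion {4} {A} {B} (Sumset.A⊆B B+C=A max-C) {2} refl
  promoted {mC = 1} B+C=A _ (1∈C , _) _ _ = 1∉A (Sumset.C⊆A B+C=A 0∈A 1∈C)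
  promoted {B} {mB = mB} {suc (suc c)} B+C=A (mB∈B , _) (mC∈C , _) mC≤mB G≐D =
    <⇒≱ (m≤m+n 5 c) (≤-trans (+-monoˡ-≤ (2 + c) 3≤mB) mB+mC≤4)
    where
    mB≡3 : mB ≡ 3
    mB≡3 = ∈zeroOneThree-≥2⇒≡3 (≐⇒⊇ G≐D (Promotion.⊆-promotion {4} {A} {B} {2 + c} mB∈B))
                               (≤-trans (s≤s (s≤s z≤n)) mC≤mB)
    3≤mB : 3 ≤ mB
    3≤mB = ≤-reflexive (sym mB≡3)
    mB+mC≤4 : mB + (2 + c) ≤ 4
    mB+mC≤4 = A⊆[4] _ (Sumset.+-∈ B+C=A mB∈B mC∈C)

  ∉InF : ∀ B → ¬ InF 4 A B zeroOneThree
  ∉InF = ¬InF unpromoted promoted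

mainTheorem15 : (k : ℕ) → 4 ≤ k → 2 ∣ k →
    (A : NSet) → 0 ∈ A → (∀ a → a ∈ A → a ≤ k) →
    (∃[ s ] (s ∈ interval k × ¬ (s ∈ A))) →
    ∃[ Fk ] (AdditiveDivisor Fk (interval k) ×
    (∀ B → AdditiveDivisor B A → ¬ InF k A B Fk))
mainTheorem15 (suc (suc j)) (s≤s (s≤s 2≤j)) 2∣k A 0∈A A⊆[k] (s , s∈[k] , s∉A)
  with (A 1 Bool.≟ true) ⊎-dec (3 ≤? j)
... | yes 1∈A⊎3≤j =
  evensUpTo j , evensUpTo-divides (2∣⇒even 2∣k) ,
  λ B _ → EvensUpToWitness.∉InF (2∣⇒even 2∣k) 2≤j A⊆[k] 0∈A (λ [k]⊆A → s∉A ([k]⊆A s∈[k])) 1∈A⊎3≤j B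
... | no ¬[1∈A⊎3≤j] with refl ← ≤-antisym (≤-pred (≰⇒> (¬[1∈A⊎3≤j] ∘ inj₂))) 2≤j =
  zeroOneThree , (interval 1 , zeroOneThree+[1]) ,
  λ B _ → ZeroOneThreeWitness.∉InF A⊆[k] 0∈A (¬[1∈A⊎3≤j] ∘ inj₁) B
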